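{- Let $l,t,s,n$ be integers with $2\le l\le t$, $s\ge l+1$ and $n\ge 2s+1$. Then $$ex(n,\{K_{l,t},M_{s+1}\},l-1)\le (l-1)n+ex(2(s-l+1)+1,K_{l,t})-\frac{l(l-1)}{2}.$$
   Context: All graphs are finite, simple and undirected. $ex(m,K_{l,t})$ is the maximum number of edges of an $m$-vertex graph with no $K_{l,t}$ subgraph ($K_{l,t}$: complete bipartite graph with parts of sizes $l,t$); $M_{s+1}$ is a matching of $s+1$ pairwise disjoint edges. For a graph $G$ with matching number at most $s$, let $\mathscr{X}(G)$ be the set of subsets $X\subseteq V(G)$ such that $|X|+\sum_{i=1}^m\lfloor |V(C_i)|/2\rfloor\le s$, where $C_1,\dots,C_m$ are the connected components of $G-X$, and let $x(G)=\max\{|X|: X\in\mathscr{X}(G)\}$. Let $\mathscr{G}_x$ be the set of graphs on $n$ vertices containing neither $K_{l,t}$ nor $M_{s+1}$ as a subgraph and with $x(G)=x$, and $ex(n,\{K_{l,t},M_{s+1}\},x)=\max_{G\in\mathscr{G}_x}e(G)$. -}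

module Defs where

open import Data.Nat using (ℕ; zero; suc; _+_; _*_; _∸_; _≤_; _<_)
open import Data.Nat.DivMod using (_/_)
open import Data.Bool using (Bool; true; false; if_then_else_; _∧_; not)
open import Data.Fin using (Fin; toℕ; _<?_)
open import Data.Fin.Properties using (_≟_)
open import Data.List using (List; map; allFin)
open import Data.Nat.ListAction using (sum)
open import Data.Product using (Σ; _×_; ∃)
open import Relation.Binary.PropositionalEquality using (_≡_; _≢_)
open import Relation.Nullary.Decidable using (⌊_⌋)
open import Function.Definitions using (Injective)
import Data.Empty

record Graph (n : ℕ) : Set where
  field
    adj    : Fin n → Fin n → Bool
    sym    : ∀ u v → adj u v ≡ adj v u
    irrefl : ∀ v → adj v v ≡ false
open Graph public

ΣFin : (n : ℕ) → (Fin n → ℕ) → ℕ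
ΣFin n f = sum (map f (allFin n))

b2n : Bool → ℕ
b2n true  = 1
b2n false = 0

edges : ∀ {n} → Graph n → ℕ
edges {n} G = ΣFin n (λ i → ΣFin n (λ j → b2n (⌊ i <? j ⌋ ∧ adj G i j)))

ContainsK : ∀ {n} → ℕ → ℕ → Graph n → Set
ContainsK {n} l t G =
  Σ (Fin l → Fin n) λ f → Σ (Fin t → Fin n) λ g →
    Injective _≡_ _≡_ f × Injective _≡_ _≡_ g ×
    (∀ i j → f i ≢ g j) × (∀ i j → adj G (f i) (g j) ≡ true)

ContainsM : ∀ {n} → ℕ → Graph n → Set
ContainsM {n} k G =
  Σ (Fin k → Fin n) λ a → Σ (Fin k → Fin n) λ b →
    Injective _≡_ _≡_ a × Injective _≡_ _≡_ b × (∀ i j → a i ≢ b j) ×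
    (∀ i → adj G (a i) (b i) ≡ true)

VSet : ℕ → Set
VSet n = Fin n → Bool

card : ∀ {n} → VSet n → ℕ
card {n} X = ΣFin n (λ v → b2n (X v))

data Reach {n : ℕ} (G : Graph n) (X : VSet n) (u : Fin n) : Fin n → Set where
  here : X u ≡ false → Reach G X u u
  step : ∀ {v w} → Reach G X u v → adj G v w ≡ true → X w ≡ false → Reach G X u w

-- A labelling of the connected components of G - X by Fin k:
-- vertices outside X get the same label iff they are in the same component,
-- and every label is used by some vertex outside X.
record ComponentLabelling {n : ℕ} (G : Graph n) (X : VSet n) (k : ℕ) : Set where
  field
    label    : Fin n → Fin k
    sound    : ∀ u v → X u ≡ false → X v ≡ false → label u ≡ label v → Reach G X u v
    complete : ∀ u v → Reach G X u v → label u ≡ label v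
    onto     : ∀ c → Σ (Fin n) λ v → (X v ≡ false) × (label v ≡ c)
open ComponentLabelling public

compSize : ∀ {n} {G : Graph n} {X : VSet n} {k} → ComponentLabelling G X k → Fin k → ℕ
compSize {n} {X = X} L c = ΣFin n (λ v → b2n (not (X v) ∧ ⌊ label L v ≟ c ⌋))

halfSum : ∀ {n} {G : Graph n} {X : VSet n} {k} → ComponentLabelling G X k → ℕ
halfSum {k = k} L = ΣFin k (λ c → compSize L c / 2)

InX : ∀ {n} → ℕ → Graph n → VSet n → Set
InX s G X = Σ ℕ λ k → Σ (ComponentLabelling G X k) λ L → card X + halfSum L ≤ s

xIs : ∀ {n} → ℕ → Graph n → ℕ → Set
xIs s G x = (Σ (VSet _) λ X → InX s G X × card X ≡ x) ×
            (∀ X → InX s G X → card X ≤ x)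

-- E is an upper bound on e(H) for all K_{l,t}-free graphs H on m vertices
-- (ex(m, K_{l,t}) is the least such E).
ExBound : ℕ → ℕ → ℕ → ℕ → Set
ExBound m l t E = (H : Graph m) → ¬K H → edges H ≤ E
  where ¬K : Graph m → Set
        ¬K H = ContainsK l t H → Data.Empty.⊥

module Submission where

-- Fix X ∈ 𝒳(G) with |X| = l − 1.
-- Counting ordered pairs, a vertex of X has at most n − 1 neighbours and a vertex outside X at
-- most l − 1 neighbours in X, so at most (l − 1)n − l(l − 1)/2 edges meet X.  In G − X, send the
-- root of every component to one vertex o and the other vertices injectively elsewhere: a component
-- C has |C| − 1 ≤ 2⌊|C|/2⌋ non-roots, so the image graph H fits on 2(s − l + 1) + 1 vertices, and
-- no two edges of G − X collapse because each lies inside a component.  A K_{l,t} in H with l, t ≥ 2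
-- is connected, hence lies over one component, on which the map is injective; so H is K_{l,t}-free
-- and e(G − X) ≤ e(H) ≤ ex(2(s − l + 1) + 1, K_{l,t}).

open import Defs renaming (sym to adj-sym)
open import Data.Bool using (Bool; true; false; not; _∧_; if_then_else_)
open import Data.Bool.Properties using (∧-zeroʳ; ∧-identityʳ; ∧-comm)
open import Data.Empty using (⊥; ⊥-elim)
open import Data.Fin as Fin using (Fin; zero; suc; toℕ; fromℕ<) renaming (_<_ to _<ᶠ_)
open import Data.Fin.Properties as Finₚ using (toℕ-injective; toℕ-fromℕ<) renaming (_≟_ to _≟ᶠ_)
open import Data.List using (tabulate)
open import Data.List.Properties using (map-tabulate)
import Data.Nat.ListAction as ListAction
open import Data.Nat using (ℕ; zero; suc; _+_; _*_; _∸_; _≤_; _<_; z≤n; s≤s; _≟_; _<?_)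
open import Data.Nat.Properties
open import Data.Nat.DivMod using (_/_; _%_; m≡m%n+[m/n]*n; m%n<n; m*n/n≡m)
open import Data.Nat.Tactic.RingSolver using (solve-∀)
open import Algebra.Properties.Semiring.Sum +-*-semiring
  using (sum-syntax; sum-cong-≗; ∑-distrib-+; ∑-comm; *-distribˡ-sum; *-distribʳ-sum)
open import Data.Product using (∃-syntax; _×_; _,_; proj₁; proj₂)
open import Function.Definitions using (Injective)
open import Function using (_∘_; id)
open import Relation.Binary.Definitions using (tri<; tri≈; tri>)
open import Relation.Binary.PropositionalEquality
open import Relation.Nullary using (Dec; yes; no; ¬_)
open import Relation.Nullary.Decidable using (⌊_⌋; isYes≗does; dec-true; dec-false; decidable-stable)

ΣFin≡∑ : ∀ n (f : Fin n → ℕ) → ΣFin n f ≡ ∑[ i < n ] f i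
ΣFin≡∑ n f = trans (cong ListAction.sum (map-tabulate id f)) (sum-tabulate n f)
  where
  sum-tabulate : ∀ n (f : Fin n → ℕ) → ListAction.sum (tabulate f) ≡ ∑[ i < n ] f i
  sum-tabulate zero    f = refl
  sum-tabulate (suc n) f = cong (f zero +_) (sum-tabulate n (f ∘ suc))

∑-mono-≤ : ∀ {n} {f g : Fin n → ℕ} → (∀ i → f i ≤ g i) → ∑[ i < n ] f i ≤ ∑[ i < n ] g i
∑-mono-≤ {zero}  f≤g = z≤n
∑-mono-≤ {suc n} f≤g = +-mono-≤ (f≤g zero) (∑-mono-≤ (f≤g ∘ suc))

∑-const : ∀ n c → ∑[ i < n ] c ≡ n * c
∑-const zero    c = refl
∑-const (suc n) c = cong (c +_) (∑-const n c)

term≤∑ : ∀ {n} (f : Fin n → ℕ) i → f i ≤ ∑[ j < n ] f j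
term≤∑ f zero    = m≤m+n _ _
term≤∑ f (suc i) = ≤-trans (term≤∑ (f ∘ suc) i) (m≤n+m _ _)

∑-positive : ∀ {n} (f : Fin n → ℕ) → 0 < ∑[ i < n ] f i → ∃[ i ] 0 < f i
∑-positive {suc n} f ∑f>0 with f zero in eq
... | suc _ = zero , subst (0 <_) (sym eq) (s≤s z≤n)
... | zero  = let i , fi>0 = ∑-positive (f ∘ suc) ∑f>0 in suc i , fi>0

∑-single : ∀ {n} (f : Fin n → ℕ) i → (∀ j → j ≢ i → f j ≡ 0) → ∑[ j < n ] f j ≡ f i
∑-single {suc n} f zero    others = trans (cong (f zero +_) (trans (sum-cong-≗ (λ j → others (suc j) (λ ())))
                                                                   (trans (∑-const n 0) (*-zeroʳ n))))
                                          (+-identityʳ (f zero))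
∑-single {suc n} f (suc i) others = trans (cong (_+ ∑[ j < n ] f (suc j)) (others zero (λ ())))
                                  (∑-single (f ∘ suc) i (λ j j≢i → others (suc j) (j≢i ∘ Finₚ.suc-injective)))

∑≤1 : ∀ {n} (f : Fin n → ℕ) → (∀ i → f i ≤ 1) → (∀ i j → 0 < f i → 0 < f j → i ≡ j) →
      ∑[ i < n ] f i ≤ 1
∑≤1 f f≤1 unique with ∑[ i < _ ] f i ≟ 0
... | yes ∑f≡0 = ≤-trans (≤-reflexive ∑f≡0) z≤n
... | no  ∑f≢0 = let i , fi>0 = ∑-positive f (n≢0⇒n>0 ∑f≢0) in
  ≤-trans (≤-reflexive (∑-single f i (λ j j≢i → n≤0⇒n≡0 (≮⇒≥ (λ fj>0 → j≢i (unique j i fj>0 fi>0))))))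
          (f≤1 i)

∑∑≤1 : ∀ {m n} (f : Fin m → Fin n → ℕ) → (∀ i j → f i j ≤ 1) →
       (∀ i j i′ j′ → 0 < f i j → 0 < f i′ j′ → i ≡ i′ × j ≡ j′) →
       ∑[ i < m ] ∑[ j < n ] f i j ≤ 1
∑∑≤1 f f≤1 unique = ∑≤1 _ row≤1 λ i i′ p q →
  proj₁ (unique i (proj₁ (∑-positive (f i) p)) i′ (proj₁ (∑-positive (f i′) q))
                  (proj₂ (∑-positive (f i) p)) (proj₂ (∑-positive (f i′) q)))
  where
  row≤1 : ∀ i → ∑[ j < _ ] f i j ≤ 1
  row≤1 i = ∑≤1 (f i) (f≤1 i) (λ j j′ p q → proj₂ (unique i j i j′ p q))

∑∑-distrib-+ : ∀ {m n} (f g : Fin m → Fin n → ℕ) →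
               ∑[ i < m ] ∑[ j < n ] (f i j + g i j) ≡ ∑[ i < m ] ∑[ j < n ] f i j + ∑[ i < m ] ∑[ j < n ] g i j
∑∑-distrib-+ {m} {n} f g = trans (sum-cong-≗ (λ i → ∑-distrib-+ (f i) (g i)))
                                  (∑-distrib-+ (λ i → ∑[ j < n ] f i j) (λ i → ∑[ j < n ] g i j))

∑∑-interchange : ∀ {m n p q} (f : Fin m → Fin n → Fin p → Fin q → ℕ) →
  ∑[ u < m ] ∑[ v < n ] ∑[ a < p ] ∑[ b < q ] f u v a b ≡ ∑[ a < p ] ∑[ b < q ] ∑[ u < m ] ∑[ v < n ] f u v a b
∑∑-interchange f = begin
  ∑[ u < _ ] ∑[ v < _ ] ∑[ a < _ ] ∑[ b < _ ] f u v a b ≡⟨ sum-cong-≗ (λ u → ∑-comm (λ v a → ∑[ b < _ ] f u v a b)) ⟩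
  ∑[ u < _ ] ∑[ a < _ ] ∑[ v < _ ] ∑[ b < _ ] f u v a b ≡⟨ ∑-comm (λ u a → ∑[ v < _ ] ∑[ b < _ ] f u v a b) ⟩
  ∑[ a < _ ] ∑[ u < _ ] ∑[ v < _ ] ∑[ b < _ ] f u v a b ≡⟨ sum-cong-≗ (λ a → sum-cong-≗ (λ u → ∑-comm (λ v b → f u v a b))) ⟩
  ∑[ a < _ ] ∑[ u < _ ] ∑[ b < _ ] ∑[ v < _ ] f u v a b ≡⟨ sum-cong-≗ (λ a → ∑-comm (λ u b → ∑[ v < _ ] f u v a b)) ⟩
  ∑[ a < _ ] ∑[ b < _ ] ∑[ u < _ ] ∑[ v < _ ] f u v a b ∎
  where open ≡-Reasoning

⌊⌋-true : ∀ {p} {P : Set p} (P? : Dec P) → P → ⌊ P? ⌋ ≡ true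
⌊⌋-true P? p = trans (isYes≗does P?) (dec-true P? p)

⌊⌋-false : ∀ {p} {P : Set p} (P? : Dec P) → ¬ P → ⌊ P? ⌋ ≡ false
⌊⌋-false P? ¬p = trans (isYes≗does P?) (dec-false P? ¬p)

⌊⌋-true⁻¹ : ∀ {p} {P : Set p} (P? : Dec P) → ⌊ P? ⌋ ≡ true → P
⌊⌋-true⁻¹ (yes p) _ = p

b2n≤1 : ∀ b → b2n b ≤ 1
b2n≤1 true  = s≤s z≤n
b2n≤1 false = z≤n

b2n-positive : ∀ {b} → 0 < b2n b → b ≡ true
b2n-positive {true} _ = refl

∧-true : ∀ {a b} → a ∧ b ≡ true → a ≡ true × b ≡ true
∧-true {true} b≡true = refl , b≡true

∧-exchange : ∀ a b c → a ∧ (b ∧ c) ≡ b ∧ (a ∧ c)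
∧-exchange true  b c = refl
∧-exchange false b c = sym (∧-zeroʳ b)

δ : ∀ {n} → Fin n → Fin n → ℕ
δ i j = b2n ⌊ i ≟ᶠ j ⌋

δ-refl : ∀ {n} (i : Fin n) → δ i i ≡ 1
δ-refl i = cong b2n (⌊⌋-true (i ≟ᶠ i) refl)

δ-≢ : ∀ {n} {i j : Fin n} → i ≢ j → δ i j ≡ 0
δ-≢ {i = i} {j} i≢j = cong b2n (⌊⌋-false (i ≟ᶠ j) i≢j)

∑-δ : ∀ {n} (i : Fin n) → ∑[ j < n ] δ i j ≡ 1
∑-δ i = trans (∑-single (δ i) i (λ j j≢i → δ-≢ (j≢i ∘ sym))) (δ-refl i)

∑-partition : ∀ {n k} (h : Fin n → ℕ) (lab : Fin n → Fin k) →
              ∑[ v < n ] h v ≡ ∑[ c < k ] ∑[ v < n ] (h v * δ (lab v) c)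
∑-partition {n} {k} h lab = begin
  ∑[ v < n ] h v                          ≡⟨ sum-cong-≗ (λ v → sym (trans (cong (h v *_) (∑-δ (lab v))) (*-identityʳ (h v)))) ⟩
  ∑[ v < n ] (h v * ∑[ c < k ] δ (lab v) c) ≡⟨ sum-cong-≗ (λ v → *-distribˡ-sum (h v) (δ (lab v))) ⟩
  ∑[ v < n ] ∑[ c < k ] (h v * δ (lab v) c) ≡⟨ ∑-comm (λ v c → h v * δ (lab v) c) ⟩
  ∑[ c < k ] ∑[ v < n ] (h v * δ (lab v) c) ∎
  where open ≡-Reasoning

count : ∀ {n} → (Fin n → Bool) → ℕ
count {n} P = ∑[ v < n ] b2n (P v)

rank : ∀ {n} → (Fin n → Bool) → Fin n → ℕ
rank P zero    = 0
rank P (suc v) = b2n (P zero) + rank (P ∘ suc) v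

rank-mono-< : ∀ {n} (P : Fin n → Bool) {u v} → u <ᶠ v → P u ≡ true → rank P u < rank P v
rank-mono-< P {zero}  {suc v} _           Pu rewrite Pu = s≤s z≤n
rank-mono-< P {suc u} {suc v} (s≤s u<v) Pu = +-monoʳ-< (b2n (P zero)) (rank-mono-< (P ∘ suc) u<v Pu)

rank<count : ∀ {n} (P : Fin n → Bool) {v} → P v ≡ true → rank P v < count P
rank<count P {zero}  Pv rewrite Pv = s≤s z≤n
rank<count P {suc v} Pv = +-monoʳ-< (b2n (P zero)) (rank<count (P ∘ suc) Pv)

rank-injective : ∀ {n} (P : Fin n → Bool) {u v} → P u ≡ true → P v ≡ true → rank P u ≡ rank P v → u ≡ v
rank-injective P {u} {v} Pu Pv ru≡rv with Finₚ.<-cmp u v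
... | tri< u<v _ _ = ⊥-elim (<-irrefl ru≡rv (rank-mono-< P u<v Pu))
... | tri≈ _ u≡v _ = u≡v
... | tri> _ _ v<u = ⊥-elim (<-irrefl (sym ru≡rv) (rank-mono-< P v<u Pv))

injective-avoids : ∀ {r m} (h : Fin (suc (suc r)) → Fin m) → Injective _≡_ _≡_ h → ∀ o → ∃[ i ] h i ≢ o
injective-avoids h h-inj o with h zero ≟ᶠ o
... | no  h0≢o = zero , h0≢o
... | yes h0≡o = suc zero , λ h1≡o → 0≢1 (h-inj (trans h0≡o (sym h1≡o)))
  where
  0≢1 : zero ≢ suc zero
  0≢1 ()

<⇒≤2*[/2] : ∀ {p q} → p < q → p ≤ 2 * (q / 2)
<⇒≤2*[/2] {p} {q} p<q = ≤-pred (≤-trans p<q q≤1+2*[q/2])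
  where
  q≤1+2*[q/2] : q ≤ suc (2 * (q / 2))
  q≤1+2*[q/2] = begin
    q                    ≡⟨ m≡m%n+[m/n]*n q 2 ⟩
    q % 2 + q / 2 * 2    ≤⟨ +-mono-≤ (≤-pred (m%n<n q 2)) (≤-reflexive (*-comm (q / 2) 2)) ⟩
    1 + 2 * (q / 2)      ∎
    where open ≤-Reasoning

[1+c]*c-even : ∀ c → 2 * (suc c * c / 2) ≡ suc c * c
[1+c]*c-even c = let q , [1+c]*c≡q*2 = even-witness c in
  trans (cong (λ x → 2 * (x / 2)) [1+c]*c≡q*2) (trans (cong (2 *_) (m*n/n≡m q 2)) (trans (*-comm 2 q) (sym [1+c]*c≡q*2)))
  where
  even-witness : ∀ c → ∃[ q ] suc c * c ≡ q * 2
  even-witness zero    = 0 , refl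
  even-witness (suc c) = let q , e = even-witness c in
    q + suc c , trans (expand c) (trans (cong (_+ 2 * suc c) e) (collect q c))
    where
    expand : ∀ c → suc (suc c) * suc c ≡ suc c * c + 2 * suc c
    expand = solve-∀
    collect : ∀ q c → q * 2 + 2 * suc c ≡ (q + suc c) * 2
    collect = solve-∀

halve-≤ : ∀ {a b} c n → 2 * a + c + c * c ≤ n * c + n * c + 2 * b → a + suc c * c / 2 ≤ c * n + b
halve-≤ {a} {b} c n 2a+c+c²≤ = *-cancelˡ-≤ 2 (begin
  2 * (a + suc c * c / 2)          ≡⟨ *-distribˡ-+ 2 a (suc c * c / 2) ⟩
  2 * a + 2 * (suc c * c / 2)      ≡⟨ cong (2 * a +_) ([1+c]*c-even c) ⟩
  2 * a + (c + c * c)              ≡⟨ sym (+-assoc (2 * a) c (c * c)) ⟩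
  2 * a + c + c * c                ≤⟨ 2a+c+c²≤ ⟩
  n * c + n * c + 2 * b            ≡⟨ regroup n c b ⟩
  2 * (c * n + b)                  ∎)
  where
  open ≤-Reasoning
  regroup : ∀ n c b → n * c + n * c + 2 * b ≡ 2 * (c * n + b)
  regroup = solve-∀

arcs : ∀ {n} → Graph n → ℕ
arcs {n} G = ∑[ u < n ] ∑[ v < n ] b2n (adj G u v)

arcs≡2*edges : ∀ {n} (G : Graph n) → arcs G ≡ 2 * edges G
arcs≡2*edges {n} G = begin
  arcs G                                                    ≡⟨ sum-cong-≗ (λ u → sum-cong-≗ (arc-split u)) ⟩
  ∑[ u < n ] ∑[ v < n ] (A u v + A v u)                     ≡⟨ ∑∑-distrib-+ A (λ u v → A v u) ⟩
  ∑[ u < n ] ∑[ v < n ] A u v + ∑[ u < n ] ∑[ v < n ] A v u ≡⟨ cong (∑[ u < n ] ∑[ v < n ] A u v +_) (∑-comm (λ u v → A v u)) ⟩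
  ∑[ u < n ] ∑[ v < n ] A u v + ∑[ u < n ] ∑[ v < n ] A u v ≡⟨ cong (λ e → e + e) (sym edges≡∑∑A) ⟩
  edges G + edges G                                         ≡⟨ cong (edges G +_) (sym (+-identityʳ (edges G))) ⟩
  2 * edges G                                               ∎
  where
  open ≡-Reasoning
  A : Fin n → Fin n → ℕ
  A u v = b2n (⌊ u Fin.<? v ⌋ ∧ adj G u v)
  edges≡∑∑A : edges G ≡ ∑[ u < n ] ∑[ v < n ] A u v
  edges≡∑∑A = trans (ΣFin≡∑ n _) (sum-cong-≗ (λ u → ΣFin≡∑ n (A u)))
  arc-split : ∀ u v → b2n (adj G u v) ≡ A u v + A v u
  arc-split u v with Finₚ.<-cmp u v
  ... | tri< u<v _ v≮u rewrite ⌊⌋-true (u Fin.<? v) u<v | ⌊⌋-false (v Fin.<? u) v≮u = sym (+-identityʳ _)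
  ... | tri≈ _ refl _  rewrite ⌊⌋-false (u Fin.<? u) (Finₚ.<-irrefl refl) | irrefl G u = refl
  ... | tri> u≮v _ v<u rewrite ⌊⌋-false (u Fin.<? v) u≮v | ⌊⌋-true (v Fin.<? u) v<u | adj-sym G v u = refl

_∖_ : ∀ {n} → Graph n → VSet n → Graph n
G ∖ X = record
  { adj    = λ u v → not (X u) ∧ (not (X v) ∧ adj G u v)
  ; sym    = λ u v → trans (cong (λ e → not (X u) ∧ (not (X v) ∧ e)) (adj-sym G u v))
                           (∧-exchange (not (X u)) (not (X v)) (adj G v u))
  ; irrefl = λ v → trans (cong (λ e → not (X v) ∧ (not (X v) ∧ e)) (irrefl G v))
                         (trans (cong (not (X v) ∧_) (∧-zeroʳ (not (X v)))) (∧-zeroʳ (not (X v))))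
  }

∖-adj : ∀ {n} (G : Graph n) (X : VSet n) {u v} → adj (G ∖ X) u v ≡ true →
        X u ≡ false × X v ≡ false × adj G u v ≡ true
∖-adj G X {u} {v} uv with X u | X v
... | false | false = refl , refl , uv

arcs-split : ∀ {n} (G : Graph n) (X : VSet n) →
             arcs G + card X + card X * card X ≤ n * card X + n * card X + arcs (G ∖ X)
arcs-split {n} G X = begin
    arcs G + card X + card X * card X
  ≡⟨ cong (λ c → arcs G + c + c * c) |X|≡∑x ⟩
    arcs G + ∑x + ∑x * ∑x
  ≡⟨ sym (trans (∑∑-distrib-+ (λ u v → a u v + xδ u v) (λ u v → x u * x v))
                (cong₂ _+_ (trans (∑∑-distrib-+ a xδ) (cong (arcs G +_) ∑∑xδ)) ∑∑xx)) ⟩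
    ∑[ u < n ] ∑[ v < n ] (a u v + xδ u v + x u * x v)
  ≤⟨ ∑-mono-≤ (λ u → ∑-mono-≤ (arc-bound u)) ⟩
    ∑[ u < n ] ∑[ v < n ] (x u + x v + a∖ u v)
  ≡⟨ ∑∑-distrib-+ (λ u v → x u + x v) a∖ ⟩
    ∑[ u < n ] ∑[ v < n ] (x u + x v) + arcs (G ∖ X)
  ≡⟨ cong (_+ arcs (G ∖ X)) (trans (∑∑-distrib-+ (λ u v → x u) (λ u v → x v)) (cong₂ _+_ ∑∑xᵤ ∑∑xᵥ)) ⟩
    n * ∑x + n * ∑x + arcs (G ∖ X)
  ≡⟨ cong (λ c → n * c + n * c + arcs (G ∖ X)) (sym |X|≡∑x) ⟩
    n * card X + n * card X + arcs (G ∖ X)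
  ∎
  where
  open ≤-Reasoning
  x : Fin n → ℕ
  x v = b2n (X v)
  ∑x : ℕ
  ∑x = ∑[ v < n ] x v
  a a∖ xδ : Fin n → Fin n → ℕ
  a u v = b2n (adj G u v)
  a∖ u v = b2n (adj (G ∖ X) u v)
  xδ u v = x u * δ u v
  |X|≡∑x : card X ≡ ∑x
  |X|≡∑x = ΣFin≡∑ n x
  ∑∑xδ : ∑[ u < n ] ∑[ v < n ] xδ u v ≡ ∑x
  ∑∑xδ = sum-cong-≗ (λ u → trans (sym (*-distribˡ-sum (x u) (δ u))) (trans (cong (x u *_) (∑-δ u)) (*-identityʳ (x u))))
  ∑∑xx : ∑[ u < n ] ∑[ v < n ] (x u * x v) ≡ ∑x * ∑x
  ∑∑xx = trans (sum-cong-≗ (λ u → sym (*-distribˡ-sum (x u) x))) (sym (*-distribʳ-sum ∑x x))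
  ∑∑xᵤ : ∑[ u < n ] ∑[ v < n ] x u ≡ n * ∑x
  ∑∑xᵤ = trans (sum-cong-≗ (λ u → ∑-const n (x u))) (sym (*-distribˡ-sum n x))
  ∑∑xᵥ : ∑[ u < n ] ∑[ v < n ] x v ≡ n * ∑x
  ∑∑xᵥ = ∑-const n ∑x
  -- Summed over v: u ∈ X has at most n − 1 neighbours, u ∉ X at most |X| neighbours in X.
  arc-bound : ∀ u v → a u v + xδ u v + x u * x v ≤ x u + x v + a∖ u v
  arc-bound u v with u ≟ᶠ v
  ... | yes refl rewrite irrefl G u = on-diagonal (X u)
    where
    on-diagonal : ∀ p → 0 + b2n p * 1 + b2n p * b2n p ≤ b2n p + b2n p + b2n (not p ∧ (not p ∧ false))
    on-diagonal true  = ≤-refl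
    on-diagonal false = ≤-refl
  ... | no _ = off-diagonal (X u) (X v) (adj G u v)
    where
    off-diagonal : ∀ p q e → b2n e + b2n p * 0 + b2n p * b2n q ≤ b2n p + b2n q + b2n (not p ∧ (not q ∧ e))
    off-diagonal true  true  true  = ≤ᵇ⇒≤ _ _ _
    off-diagonal true  true  false = ≤ᵇ⇒≤ _ _ _
    off-diagonal true  false true  = ≤ᵇ⇒≤ _ _ _
    off-diagonal true  false false = ≤ᵇ⇒≤ _ _ _
    off-diagonal false true  true  = ≤ᵇ⇒≤ _ _ _
    off-diagonal false true  false = ≤ᵇ⇒≤ _ _ _
    off-diagonal false false true  = ≤ᵇ⇒≤ _ _ _
    off-diagonal false false false = ≤ᵇ⇒≤ _ _ _

module Contraction {n k m : ℕ} (G : Graph n) (X : VSet n) (L : ComponentLabelling G X k)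
  (φ : Fin n → Fin m) (o : Fin m)
  (φ-injective-off-o : ∀ {u v} → φ u ≡ φ v → φ u ≢ o → u ≡ v)
  (φ-injective-on-components : ∀ {u v} → X u ≡ false → X v ≡ false →
                               label L u ≡ label L v → φ u ≡ φ v → u ≡ v)
  where

  record Lift (a b : Fin m) : Set where
    field
      src dst : Fin n
      src∉X   : X src ≡ false
      dst∉X   : X dst ≡ false
      arc     : adj G src dst ≡ true
      src↦a   : φ src ≡ a
      dst↦b   : φ dst ≡ b

    same-component : label L src ≡ label L dst
    same-component = complete L src dst (step (here src∉X) arc dst∉X)

  open Lift

  over : Fin n → Fin n → Fin m → Fin m → ℕ
  over u v a b = b2n (adj (G ∖ X) u v ∧ (⌊ φ u ≟ᶠ a ⌋ ∧ ⌊ φ v ≟ᶠ b ⌋))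

  fibre : Fin m → Fin m → ℕ
  fibre a b = ∑[ u < n ] ∑[ v < n ] over u v a b

  lift : ∀ {u v a b} → 0 < over u v a b → Lift a b
  lift {u} {v} {a} {b} w>0 =
    let uv , ua∧vb = ∧-true (b2n-positive w>0)
        ua , vb = ∧-true ua∧vb
        u∉X , v∉X , uv′ = ∖-adj G X uv
    in record { src = u ; dst = v ; src∉X = u∉X ; dst∉X = v∉X ; arc = uv′
              ; src↦a = ⌊⌋-true⁻¹ (φ u ≟ᶠ a) ua ; dst↦b = ⌊⌋-true⁻¹ (φ v ≟ᶠ b) vb }

  lift-of-fibre : ∀ {a b} → 0 < fibre a b → Lift a b
  lift-of-fibre {a} {b} fibre>0 =
    let u , row>0 = ∑-positive (λ u → ∑[ v < n ] over u v a b) fibre>0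
        v , w>0   = ∑-positive (λ v → over u v a b) row>0
    in lift w>0

  no-loop : ∀ {a} → Lift a a → ⊥
  no-loop p with φ-injective-on-components (src∉X p) (dst∉X p) (same-component p)
                                           (trans (src↦a p) (sym (dst↦b p)))
  ... | src≡dst = true≢false (trans (sym (arc p)) (trans (cong (adj G (src p)) (sym src≡dst)) (irrefl G (src p))))
    where
    true≢false : true ≢ false
    true≢false ()

  dst-determined : ∀ {a b} (p q : Lift a b) → src p ≡ src q → dst p ≡ dst q
  dst-determined p q src≡ =
    φ-injective-on-components (dst∉X p) (dst∉X q)
      (trans (sym (same-component p)) (trans (cong (label L) src≡) (same-component q)))
      (trans (dst↦b p) (sym (dst↦b q)))

  src-determined : ∀ {a b} (p q : Lift a b) → dst p ≡ dst q → src p ≡ src q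
  src-determined p q dst≡ =
    φ-injective-on-components (src∉X p) (src∉X q)
      (trans (same-component p) (trans (cong (label L) dst≡) (sym (same-component q))))
      (trans (src↦a p) (sym (src↦a q)))

  src-unique : ∀ {a b b′} → a ≢ o → (p : Lift a b) (q : Lift a b′) → src p ≡ src q
  src-unique a≢o p q = φ-injective-off-o (trans (src↦a p) (sym (src↦a q))) (a≢o ∘ trans (sym (src↦a p)))

  dst-unique : ∀ {a a′ b} → b ≢ o → (p : Lift a b) (q : Lift a′ b) → dst p ≡ dst q
  dst-unique b≢o p q = φ-injective-off-o (trans (dst↦b p) (sym (dst↦b q))) (b≢o ∘ trans (sym (dst↦b p)))

  -- At most one endpoint of an arc is sent to o, and the other endpoint pins down the arc.
  lift-unique : ∀ {a b} (p q : Lift a b) → src p ≡ src q × dst p ≡ dst q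
  lift-unique {a} {b} p q with a ≟ᶠ o
  ... | no a≢o = let src≡ = src-unique a≢o p q in src≡ , dst-determined p q src≡
  ... | yes refl = src-determined p q dst≡ , dst≡
    where
    b≢o : b ≢ o
    b≢o refl = no-loop p
    dst≡ : dst p ≡ dst q
    dst≡ = dst-unique b≢o p q

  fibre-sym : ∀ a b → fibre a b ≡ fibre b a
  fibre-sym a b = trans (sum-cong-≗ (λ u → sum-cong-≗ (λ v → over-sym u v)))
                        (∑-comm (λ u v → over v u b a))
    where
    over-sym : ∀ u v → over u v a b ≡ over v u b a
    over-sym u v = cong b2n (cong₂ _∧_ (adj-sym (G ∖ X) u v) (∧-comm ⌊ φ u ≟ᶠ a ⌋ ⌊ φ v ≟ᶠ b ⌋))

  H : Graph m
  H = record
    { adj    = λ a b → ⌊ 0 <? fibre a b ⌋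
    ; sym    = λ a b → cong (λ f → ⌊ 0 <? f ⌋) (fibre-sym a b)
    ; irrefl = λ a → ⌊⌋-false (0 <? fibre a a) (no-loop ∘ lift-of-fibre)
    }

  lift-of-adj : ∀ {a b} → adj H a b ≡ true → Lift a b
  lift-of-adj {a} {b} ab = lift-of-fibre (⌊⌋-true⁻¹ (0 <? fibre a b) ab)

  fibre≤adj : ∀ a b → fibre a b ≤ b2n (adj H a b)
  fibre≤adj a b with 0 <? fibre a b
  ... | yes _        = ∑∑≤1 (λ u v → over u v a b) (λ u v → b2n≤1 _)
                            (λ u v u′ v′ p q → lift-unique (lift p) (lift q))
  ... | no  fibre≯0 = ≮⇒≥ fibre≯0

  arcs∖≤2*edges : arcs (G ∖ X) ≤ 2 * edges H
  arcs∖≤2*edges = begin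
    arcs (G ∖ X)                                             ≤⟨ ∑-mono-≤ (λ u → ∑-mono-≤ (arc≤overs u)) ⟩
    ∑[ u < n ] ∑[ v < n ] ∑[ a < m ] ∑[ b < m ] over u v a b ≡⟨ ∑∑-interchange over ⟩
    ∑[ a < m ] ∑[ b < m ] fibre a b                          ≤⟨ ∑-mono-≤ (λ a → ∑-mono-≤ (fibre≤adj a)) ⟩
    arcs H                                                   ≡⟨ arcs≡2*edges H ⟩
    2 * edges H                                              ∎
    where
    open ≤-Reasoning
    arc≤overs : ∀ u v → b2n (adj (G ∖ X) u v) ≤ ∑[ a < m ] ∑[ b < m ] over u v a b
    arc≤overs u v = begin
      b2n (adj (G ∖ X) u v)              ≡⟨ cong b2n (sym (trans (cong₂ (λ p q → adj (G ∖ X) u v ∧ (p ∧ q))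
                                                                      (⌊⌋-true (φ u ≟ᶠ φ u) refl) (⌊⌋-true (φ v ≟ᶠ φ v) refl))
                                                               (∧-identityʳ _))) ⟩
      over u v (φ u) (φ v)               ≤⟨ term≤∑ (over u v (φ u)) (φ v) ⟩
      ∑[ b < m ] over u v (φ u) b        ≤⟨ term≤∑ (λ a → ∑[ b < m ] over u v a b) (φ u) ⟩
      ∑[ a < m ] ∑[ b < m ] over u v a b ∎

  module _ {l t} (f : Fin (suc (suc l)) → Fin m) (g : Fin (suc (suc t)) → Fin m)
    (f-injective : Injective _≡_ _≡_ f) (g-injective : Injective _≡_ _≡_ g)
    (f≢g : ∀ i j → f i ≢ g j) (f-g-adj : ∀ i j → adj H (f i) (g j) ≡ true) where

    private
      W : ∀ i j → Lift (f i) (g j)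
      W i j = lift-of-adj (f-g-adj i j)

      U V : Fin (suc (suc l)) → Fin (suc (suc t)) → Fin n
      U i j = src (W i j)
      V i j = dst (W i j)

      U-fixed : ∀ {i} → f i ≢ o → ∀ j j′ → U i j ≡ U i j′
      U-fixed fi≢o j j′ = src-unique fi≢o (W _ j) (W _ j′)

      V-fixed : ∀ {j} → g j ≢ o → ∀ i i′ → V i j ≡ V i′ j
      V-fixed gj≢o i i′ = dst-unique gj≢o (W i _) (W i′ _)

      i₀ : Fin (suc (suc l))
      i₀ = proj₁ (injective-avoids f f-injective o)
      j₀ : Fin (suc (suc t))
      j₀ = proj₁ (injective-avoids g g-injective o)

      -- As l, t ≥ 2, each side of the K has a vertex i₀, j₀ off o; through them the lifted arcs
      -- are all connected, so they lie in one component κ.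
      κ : Fin k
      κ = label L (U i₀ j₀)

      U∈κ : ∀ i j → label L (U i j) ≡ κ
      U∈κ i j with g j ≟ᶠ o
      ... | no gj≢o = begin
        label L (U i j)   ≡⟨ same-component (W i j) ⟩
        label L (V i j)   ≡⟨ cong (label L) (V-fixed gj≢o i i₀) ⟩
        label L (V i₀ j)  ≡⟨ sym (same-component (W i₀ j)) ⟩
        label L (U i₀ j)  ≡⟨ cong (label L) (U-fixed (proj₂ (injective-avoids f f-injective o)) j j₀) ⟩
        κ                 ∎
        where open ≡-Reasoning
      ... | yes gj≡o = begin
        label L (U i j)   ≡⟨ cong (label L) (U-fixed (λ fi≡o → f≢g i j (trans fi≡o (sym gj≡o))) j j₀) ⟩
        label L (U i j₀)  ≡⟨ same-component (W i j₀) ⟩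
        label L (V i j₀)  ≡⟨ cong (label L) (V-fixed (proj₂ (injective-avoids g g-injective o)) i i₀) ⟩
        label L (V i₀ j₀) ≡⟨ sym (same-component (W i₀ j₀)) ⟩
        κ                 ∎
        where open ≡-Reasoning

      V∈κ : ∀ i j → label L (V i j) ≡ κ
      V∈κ i j = trans (sym (same-component (W i j))) (U∈κ i j)

      U-const : ∀ i j → U i j ≡ U i zero
      U-const i j = φ-injective-on-components (src∉X (W i j)) (src∉X (W i zero))
                      (trans (U∈κ i j) (sym (U∈κ i zero))) (trans (src↦a (W i j)) (sym (src↦a (W i zero))))

      V-const : ∀ i j → V i j ≡ V zero j
      V-const i j = φ-injective-on-components (dst∉X (W i j)) (dst∉X (W zero j))
                      (trans (V∈κ i j) (sym (V∈κ zero j))) (trans (dst↦b (W i j)) (sym (dst↦b (W zero j))))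

    pullback-K : ContainsK (suc (suc l)) (suc (suc t)) G
    pullback-K =
      (λ i → U i zero) , (λ j → V zero j) ,
      (λ {i} {i′} Ui≡Ui′ → f-injective (trans (sym (src↦a (W i zero))) (trans (cong φ Ui≡Ui′) (src↦a (W i′ zero))))) ,
      (λ {j} {j′} Vj≡Vj′ → g-injective (trans (sym (dst↦b (W zero j))) (trans (cong φ Vj≡Vj′) (dst↦b (W zero j′))))) ,
      (λ i j Ui≡Vj → f≢g i j (trans (sym (src↦a (W i zero))) (trans (cong φ Ui≡Vj) (dst↦b (W zero j))))) ,
      (λ i j → subst₂ (λ x y → adj G x y ≡ true) (U-const i j) (V-const i j) (arc (W i j)))

  K-free : ∀ {l t} → 2 ≤ l → 2 ≤ t → (ContainsK l t G → ⊥) → ContainsK l t H → ⊥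
  K-free {suc (suc l)} {suc (suc t)} (s≤s (s≤s z≤n)) (s≤s (s≤s z≤n)) G-K-free (f , g , f-inj , g-inj , f≢g , f-g-adj) =
    G-K-free (pullback-K f g f-inj g-inj f≢g f-g-adj)

module RootCompression {n k} (G : Graph n) (X : VSet n) (L : ComponentLabelling G X k) where

  root : Fin k → Fin n
  root c = proj₁ (onto L c)

  root∉X : ∀ c → X (root c) ≡ false
  root∉X c = proj₁ (proj₂ (onto L c))

  label-root : ∀ c → label L (root c) ≡ c
  label-root c = proj₂ (proj₂ (onto L c))

  nonRoot : Fin n → Bool
  nonRoot v = not (X v) ∧ not ⌊ root (label L v) ≟ᶠ v ⌋

  code : Fin n → ℕ
  code v = if nonRoot v then suc (rank nonRoot v) else 0

  code-nonRoot : ∀ {v} → nonRoot v ≡ true → code v ≡ suc (rank nonRoot v)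
  code-nonRoot nonRoot-v rewrite nonRoot-v = refl

  code-positive : ∀ {v} → code v ≢ 0 → nonRoot v ≡ true
  code-positive {v} code≢0 with nonRoot v
  ... | true  = refl
  ... | false = ⊥-elim (code≢0 refl)

  code≤count : ∀ v → code v ≤ count nonRoot
  code≤count v with nonRoot v in nonRoot-v
  ... | true  = rank<count nonRoot nonRoot-v
  ... | false = z≤n

  is-root : ∀ {v} → X v ≡ false → code v ≡ 0 → root (label L v) ≡ v
  is-root {v} v∉X code≡0 = decidable-stable (root (label L v) ≟ᶠ v) λ root≢v →
    0≢1+n (trans (sym code≡0) (code-nonRoot (cong₂ (λ x r → not x ∧ not r) v∉X (⌊⌋-false (root (label L v) ≟ᶠ v) root≢v))))

  code-injective-off-0 : ∀ {u v} → code u ≡ code v → code u ≢ 0 → u ≡ v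
  code-injective-off-0 {u} {v} cu≡cv cu≢0 =
    rank-injective nonRoot nonRoot-u nonRoot-v
      (suc-injective (trans (sym (code-nonRoot nonRoot-u)) (trans cu≡cv (code-nonRoot nonRoot-v))))
    where
    nonRoot-u : nonRoot u ≡ true
    nonRoot-u = code-positive cu≢0
    nonRoot-v : nonRoot v ≡ true
    nonRoot-v = code-positive (cu≢0 ∘ trans cu≡cv)

  code-injective-on-components : ∀ {u v} → X u ≡ false → X v ≡ false →
                                 label L u ≡ label L v → code u ≡ code v → u ≡ v
  code-injective-on-components {u} {v} u∉X v∉X lu≡lv cu≡cv with code u ≟ 0
  ... | no  cu≢0 = code-injective-off-0 cu≡cv cu≢0
  ... | yes cu≡0 = trans (sym (is-root u∉X cu≡0))
                         (trans (cong root lu≡lv) (is-root v∉X (trans (sym cu≡cv) cu≡0)))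

  nonRoots<compSize : ∀ c → ∑[ v < n ] (b2n (nonRoot v) * δ (label L v) c) < compSize L c
  nonRoots<compSize c = begin
    suc (∑[ v < n ] nonRoot-in v)                         ≡⟨ +-comm 1 _ ⟩
    ∑[ v < n ] nonRoot-in v + 1                           ≡⟨ cong (∑[ v < n ] nonRoot-in v +_) (sym (∑-δ (root c))) ⟩
    ∑[ v < n ] nonRoot-in v + ∑[ v < n ] δ (root c) v     ≡⟨ sym (∑-distrib-+ nonRoot-in (δ (root c))) ⟩
    ∑[ v < n ] (nonRoot-in v + δ (root c) v)              ≤⟨ ∑-mono-≤ pointwise ⟩
    ∑[ v < n ] b2n (not (X v) ∧ ⌊ label L v ≟ᶠ c ⌋)      ≡⟨ sym (ΣFin≡∑ n _) ⟩
    compSize L c                                          ∎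
    where
    open ≤-Reasoning
    nonRoot-in : Fin n → ℕ
    nonRoot-in v = b2n (nonRoot v) * δ (label L v) c
    pointwise : ∀ v → nonRoot-in v + δ (root c) v ≤ b2n (not (X v) ∧ ⌊ label L v ≟ᶠ c ⌋)
    pointwise v with root c ≟ᶠ v
    ... | yes refl rewrite root∉X c | label-root c | ⌊⌋-true (root c ≟ᶠ root c) refl
                         | ⌊⌋-true (c ≟ᶠ c) refl = ≤-refl
    ... | no _ with X v | root (label L v) ≟ᶠ v | label L v ≟ᶠ c
    ...   | true  | _     | _     = z≤n
    ...   | false | yes _ | _     = z≤n
    ...   | false | no _  | yes _ = ≤-refl
    ...   | false | no _  | no _  = ≤-refl

  count-nonRoot≤ : count nonRoot ≤ 2 * halfSum L
  count-nonRoot≤ = begin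
    count nonRoot                                                ≡⟨ ∑-partition (λ v → b2n (nonRoot v)) (label L) ⟩
    ∑[ c < k ] ∑[ v < n ] (b2n (nonRoot v) * δ (label L v) c)    ≤⟨ ∑-mono-≤ (λ c → <⇒≤2*[/2] (nonRoots<compSize c)) ⟩
    ∑[ c < k ] (2 * (compSize L c / 2))                          ≡⟨ sym (*-distribˡ-sum 2 (λ c → compSize L c / 2)) ⟩
    2 * ∑[ c < k ] (compSize L c / 2)                            ≡⟨ cong (2 *_) (sym (ΣFin≡∑ k _)) ⟩
    2 * halfSum L                                                ∎
    where open ≤-Reasoning

  module _ {m} (room : 2 * halfSum L < m) where

    φ : Fin n → Fin m
    φ v = fromℕ< (≤-<-trans (≤-trans (code≤count v) count-nonRoot≤) room)

    o : Fin m
    o = fromℕ< (≤-<-trans z≤n room)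

    code-φ : ∀ {u v} → φ u ≡ φ v → code u ≡ code v
    code-φ {u} {v} φu≡φv = trans (sym (toℕ-fromℕ< _)) (trans (cong toℕ φu≡φv) (toℕ-fromℕ< _))

    φ-injective-off-o : ∀ {u v} → φ u ≡ φ v → φ u ≢ o → u ≡ v
    φ-injective-off-o φu≡φv φu≢o =
      code-injective-off-0 (code-φ φu≡φv) (λ cu≡0 → φu≢o (toℕ-injective (trans (toℕ-fromℕ< _) (trans cu≡0 (sym (toℕ-fromℕ< _))))))

    φ-injective-on-components : ∀ {u v} → X u ≡ false → X v ≡ false →
                                label L u ≡ label L v → φ u ≡ φ v → u ≡ v
    φ-injective-on-components u∉X v∉X lu≡lv φu≡φv =
      code-injective-on-components u∉X v∉X lu≡lv (code-φ φu≡φv)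

lemma3p2 : (l t s n : ℕ) → 2 ≤ l → l ≤ t → l + 1 ≤ s → 2 * s + 1 ≤ n →
    (G : Graph n) → (ContainsK l t G → ⊥) → (ContainsM (s + 1) G → ⊥) →
    xIs s G (l ∸ 1) →
    (E : ℕ) → ExBound (2 * (s + 1 ∸ l) + 1) l t E →
    edges G + (l * (l ∸ 1)) / 2 ≤ (l ∸ 1) * n + E
lemma3p2 zero _ _ _ () _ _ _ _ _ _ _ _ _
lemma3p2 (suc c) t s n 2≤l l≤t _ _ G G-K-free _ ((X , (k , L , |X|+half≤s) , |X|≡c) , _) E ex-bound =
  halve-≤ c n (begin
    2 * edges G + c + c * c                 ≡⟨ cong₂ (λ e x → e + x + x * x) (sym (arcs≡2*edges G)) (sym |X|≡c) ⟩
    arcs G + card X + card X * card X       ≤⟨ arcs-split G X ⟩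
    n * card X + n * card X + arcs (G ∖ X)  ≤⟨ +-monoʳ-≤ (n * card X + n * card X) (≤-trans arcs∖≤2*edges (*-monoʳ-≤ 2 e[H]≤E)) ⟩
    n * card X + n * card X + 2 * E         ≡⟨ cong (λ x → n * x + n * x + 2 * E) |X|≡c ⟩
    n * c + n * c + 2 * E                   ∎)
  where
  open ≤-Reasoning
  open RootCompression G X L
  half≤s∸c : halfSum L ≤ s ∸ c
  half≤s∸c = m+n≤o⇒m≤o∸n (halfSum L) (subst (λ x → halfSum L + x ≤ s) |X|≡c (subst (_≤ s) (+-comm (card X) (halfSum L)) |X|+half≤s))
  room : 2 * halfSum L < 2 * (s + 1 ∸ suc c) + 1
  room = subst (2 * halfSum L <_) (trans (+-comm 1 _) (cong (λ x → 2 * (x ∸ suc c) + 1) (+-comm 1 s)))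
               (s≤s (*-monoʳ-≤ 2 half≤s∸c))
  open Contraction G X L (φ room) (o room) (φ-injective-off-o room) (φ-injective-on-components room)
  e[H]≤E : edges H ≤ E
  e[H]≤E = ex-bound H (K-free 2≤l (≤-trans 2≤l l≤t) G-K-free)
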